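{- There exist graphs $G$ and $H$ such that $\operatorname{ecw}(G-e)>\operatorname{ecw}(G)$ for some edge $e\in E(G)$, and $\operatorname{ecw}(H-v)>\operatorname{ecw}(H)$ for some vertex $v\in V(H)$.
   Context: Graphs are finite and undirected; $G-e$ and $H-v$ denote edge and vertex deletion. Edge-cut width: for a graph $G$ and a maximal spanning forest $T$ of $G$, the local feedback edge set at $v\in V(G)$ is $E_{\mathrm{loc}}^{G,T}(v)=\{uw\in E(G)\setminus E(T) : \text{the unique path between } u \text{ and } w \text{ in } T \text{ contains } v\}$. The edge-cut width of $(G,T)$ is $\operatorname{ecw}(G,T)=1+\max_{v\in V(G)}|E_{\mathrm{loc}}^{G,T}(v)|$, and $\operatorname{ecw}(G)$ is the minimum of $\operatorname{ecw}(G,T)$ over all maximal spanning forests $T$ of $G$. -}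

module Defs where

open import Data.Nat using (ℕ; zero; suc; _≤_; _<_; _⊔_)
open import Data.Fin using (Fin; toℕ; punchIn)
open import Data.List using (List; []; _∷_; length; foldr; map)
open import Data.List.Relation.Unary.Unique.Propositional using (Unique)
open import Data.List.Membership.Propositional using (_∈_)
open import Data.List.Relation.Unary.Any using (here; there)
open import Data.Product using (Σ; _×_; _,_; ∃)
open import Data.Empty using (⊥)
open import Relation.Nullary using (¬_)
open import Relation.Binary.PropositionalEquality using (_≡_)
open import Function.Bundles using (_⇔_)
open import Data.Sum using (_⊎_)

Rel : ℕ → Set₁
Rel n = Fin n → Fin n → Set

record Graph (n : ℕ) : Set₁ where
  field
    E     : Rel n
    sym   : ∀ {u w} → E u w → E w u
    irref : ∀ {u} → ¬ E u u
open Graph public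

SamePair : ∀ {n} → Fin n → Fin n → Fin n → Fin n → Set
SamePair u w a b = (u ≡ a × w ≡ b) ⊎ (u ≡ b × w ≡ a)

_-ᵉ_ : ∀ {n} → (G : Graph n) → Σ (Fin n) (λ a → Σ (Fin n) (λ b → E G a b)) → Graph n
G -ᵉ (a , b , _) = record
  { E     = λ u w → E G u w × ¬ SamePair u w a b
  ; sym   = λ { (e , ne) → sym G e , λ { (_⊎_.inj₁ (p , q)) → ne (_⊎_.inj₂ (q , p))
                                        ; (_⊎_.inj₂ (p , q)) → ne (_⊎_.inj₁ (q , p)) } }
  ; irref = λ { (e , _) → irref G e }
  }

_-ᵛ_ : ∀ {m} → Graph (suc m) → Fin (suc m) → Graph m
H -ᵛ v = record
  { E     = λ u w → E H (punchIn v u) (punchIn v w)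
  ; sym   = sym H
  ; irref = irref H
  }

data Walk {n} (R : Rel n) : Fin n → Fin n → Set where
  [_] : ∀ u → Walk R u u
  _∷_ : ∀ {u v w} → R u v → Walk R v w → Walk R u w

verts : ∀ {n} {R : Rel n} {u w} → Walk R u w → List (Fin n)
verts [ u ]          = u ∷ []
verts (_∷_ {u} _ p)  = u ∷ verts p

Path : ∀ {n} → Rel n → Fin n → Fin n → Set
Path R u w = Σ (Walk R u w) λ p → Unique (verts p)

Connected : ∀ {n} → Rel n → Fin n → Fin n → Set
Connected R u w = Path R u w

HasCycle : ∀ {n} → Rel n → Set
HasCycle R = Σ _ λ u → Σ _ λ w → Σ (Path R u w) λ p →
  (3 ≤ length (verts (Data.Product.proj₁ p))) × R w u

-- Maximal spanning forest T of G: symmetric subgraph of G on all vertices,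
-- acyclic, and every edge of G joins vertices connected in T
-- (i.e. each component of G is spanned by a tree of T).
record MaxSpanningForest {n} (G : Graph n) : Set₁ where
  field
    T        : Rel n
    T-sym    : ∀ {u w} → T u w → T w u
    T⊆E      : ∀ {u w} → T u w → E G u w
    acyclic  : ¬ HasCycle T
    maximal  : ∀ {u w} → E G u w → Connected T u w
open MaxSpanningForest public

HasSize : {A : Set} → (A → Set) → ℕ → Set
HasSize {A} P k = Σ (List A) λ L → Unique L × (∀ x → (x ∈ L) ⇔ P x) × length L ≡ k

maxFin : ∀ {n} → (Fin n → ℕ) → ℕ
maxFin {zero}  f = 0
maxFin {suc n} f = f Fin.zero ⊔ maxFin (λ i → f (Fin.suc i))

-- local feedback edge set at v; an unordered edge {u,w} is represented by
-- the pair (u , w) with toℕ u < toℕ w.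
Eloc : ∀ {n} (G : Graph n) (F : MaxSpanningForest G) → Fin n → Σ (Fin n) (λ _ → Fin n) → Set
Eloc G F v (u , w) =
  (toℕ u < toℕ w) × E G u w × ¬ T F u w ×
  Σ (Path (T F) u w) λ p → v ∈ verts (Data.Product.proj₁ p)

EcwT : ∀ {n} (G : Graph n) → MaxSpanningForest G → ℕ → Set
EcwT {n} G F k = Σ (Fin n → ℕ) λ s →
  (∀ v → HasSize (Eloc G F v) (s v)) × k ≡ suc (maxFin s)

Ecw : ∀ {n} → Graph n → ℕ → Set₁
Ecw G k = (Σ (MaxSpanningForest G) λ F → EcwT G F k)
        × (∀ (F : MaxSpanningForest G) k' → EcwT G F k' → k ≤ k')

-- Let K be K_{2,3}, with poles 0, 1 and hubs 2, 3, 4, in which every hub carries two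
-- triangles. Then ecw K = 5, whereas G = K + 01 and the graph H obtained from K by adding a
-- vertex adjacent to both poles have edge-cut width 4; and G - 01 = H - 0 = K.
--
-- Upper bounds are realised by explicit spanning trees. For the lower bounds let T be any
-- spanning tree. In a triangle at x, either an edge at x is a non-tree edge, or the opposite
-- edge is one whose tree path runs through x; so every hub gains two local feedback edges
-- from its triangles. In K, T restricted to K_{2,3} is a spanning tree using both edges of
-- exactly one hub c (two such hubs close a 4-cycle, none leaves K_{2,3} disconnected), and the
-- remaining two non-tree edges of K_{2,3} have their tree paths through c: so c has 4 local
-- feedback edges. In G and H the triangle 0 1 2, respectively the 4-cycle through the new
-- vertex, the poles and a hub, yields a third one at that hub.

module Submission where

open import Defs hiding (sym)
open import Data.Bool using (if_then_else_)
open import Data.Empty using (⊥; ⊥-elim)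
open import Data.Fin using (Fin; toℕ; #_; punchIn)
open import Data.Fin.Properties using (_≟_; all?; any?)
import Data.List as List
open import Data.List using (List; []; _∷_; _++_; length; filter; cartesianProduct; allFin)
open import Data.List.Properties using (length-removeAt′)
open import Data.List.Membership.Propositional using (_∈_; _∉_)
open import Data.List.Membership.Propositional.Properties
  using (∈-filter⁺; ∈-filter⁻; ∈-cartesianProduct⁺; ∈-allFin)
import Data.List.Membership.DecPropositional as DecMembership
open import Data.List.Relation.Binary.Subset.Propositional using (_⊆_)
open import Data.List.Relation.Unary.All as All using (All; []; _∷_)
open import Data.List.Relation.Unary.All.Properties using (¬Any⇒All¬; All¬⇒¬Any)
open import Data.List.Relation.Unary.AllPairs using ([]; _∷_)
open import Data.List.Relation.Unary.Any as Any using (Any; here; there; _─_)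
open import Data.List.Relation.Unary.Unique.Propositional using (Unique)
open import Data.List.Relation.Unary.Unique.Propositional.Properties
  using (filter⁺; cartesianProduct⁺; allFin⁺)
open import Data.List.Relation.Unary.Unique.DecPropositional using (unique?)
open import Data.Maybe using (Maybe; just; nothing)
open import Data.Maybe.Properties using (≡-dec)
import Data.Nat as ℕ
open import Data.Nat using (ℕ; zero; suc; _≤_; _<_; z≤n; s≤s)
open import Data.Nat.Properties using (≤-trans; <-trans; <-irrefl; m≤m⊔n; m≤n⊔m; n<1+n; _≤?_; _<?_)
import Data.Product as Product
open import Data.Product using (Σ; ∃; _×_; _,_; proj₁; proj₂)
open import Data.Product.Properties using () renaming (≡-dec to ≡-dec×)
open import Data.Sum using (_⊎_; inj₁; inj₂; swap)
import Data.Vec as Vec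
open import Data.Vec using ([]; _∷_)
open import Effect.Monad using (RawMonad)
open import Function using (_∘_; id)
open import Function.Bundles using (_⇔_; mk⇔; Equivalence)
open import Function.Construct.Composition using (_⇔-∘_)
open import Function.Construct.Symmetry using (⇔-sym)
open import Level using (0ℓ)
open import Relation.Binary.Definitions using (DecidableEquality)
open import Relation.Binary.PropositionalEquality using (_≡_; _≢_; refl; sym; trans; subst)
open import Relation.Nullary using (¬_; Dec; does; yes; no; ¬?; _×-dec_; _⊎-dec_; _→-dec_)
open import Relation.Nullary.Decidable
  using (True; toWitness; fromWitness; from-yes; map′; decidable-stable; ¬¬-excluded-middle)
open import Relation.Nullary.Negation using (¬¬-Monad)

module _ {n} {R : Rel n} where
  open DecMembership (_≟_ {n}) using (_∈?_)

  head∈ : ∀ {u w} (p : Walk R u w) → u ∈ verts p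
  head∈ [ u ]   = here refl
  head∈ (_ ∷ _) = here refl

  last∈ : ∀ {u w} (p : Walk R u w) → w ∈ verts p
  last∈ [ u ]   = here refl
  last∈ (_ ∷ p) = there (last∈ p)

  _▷_ : ∀ {u v w} → Walk R u v → R v w → Walk R u w
  [ u ]   ▷ e = e ∷ [ _ ]
  (f ∷ p) ▷ e = f ∷ (p ▷ e)

  ∈-▷ : ∀ {u v w x} (p : Walk R u v) (e : R v w) → x ∈ verts (p ▷ e) → x ∈ verts p ⊎ x ≡ w
  ∈-▷ [ u ]   e (here refl)         = inj₁ (here refl)
  ∈-▷ [ u ]   e (there (here refl)) = inj₂ refl
  ∈-▷ (f ∷ p) e (here refl)         = inj₁ (here refl)
  ∈-▷ (f ∷ p) e (there i) with ∈-▷ p e i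
  ... | inj₁ j = inj₁ (there j)
  ... | inj₂ x≡w = inj₂ x≡w

  _++ᵂ_ : ∀ {u v w} → Walk R u v → Walk R v w → Walk R u w
  [ u ]   ++ᵂ q = q
  (e ∷ p) ++ᵂ q = e ∷ (p ++ᵂ q)

  reverseᵂ : (∀ {x y} → R x y → R y x) → ∀ {u w} → Walk R u w → Walk R w u
  reverseᵂ R-sym [ u ]   = [ u ]
  reverseᵂ R-sym (e ∷ p) = reverseᵂ R-sym p ▷ R-sym e

  walk-exits : (S Q : Fin n → Set) → (∀ {x y} → S x → R x y → S y ⊎ Q y) →
               ∀ {u w} → S u → ¬ S w → (p : Walk R u w) → Any Q (verts p)
  walk-exits S Q closed Su ¬Sw [ u ] = ⊥-elim (¬Sw Su)
  walk-exits S Q closed Su ¬Sw (e ∷ p) with closed Su e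
  ... | inj₁ Sv = there (walk-exits S Q closed Sv ¬Sw p)
  ... | inj₂ Qv = there (Any.map (λ { refl → Qv }) (head∈ p))

  suffix-path : ∀ {u w z} (p : Walk R u w) → Unique (verts p) → z ∈ verts p →
                Σ (Path R z w) λ q → verts (proj₁ q) ⊆ verts p
  suffix-path [ u ]   up       (here refl) = ([ u ] , up) , id
  suffix-path (e ∷ p) up       (here refl) = (e ∷ p , up) , id
  suffix-path (e ∷ p) (_ ∷ up) (there z∈p) with suffix-path p up z∈p
  ... | q , q⊆p = q , there ∘ q⊆p

  loop-erase : ∀ {u w} (p : Walk R u w) → Σ (Path R u w) λ q → verts (proj₁ q) ⊆ verts p
  loop-erase [ u ] = ([ u ] , [] ∷ []) , id
  loop-erase (_∷_ {u} e p) with loop-erase p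
  ... | (q , uq) , q⊆p with u ∈? verts q
  ...   | yes u∈q = let r , r⊆q = suffix-path q uq u∈q in r , there ∘ q⊆p ∘ r⊆q
  ...   | no  u∉q = (e ∷ q , ¬Any⇒All¬ (verts q) u∉q ∷ uq) ,
                    λ { (here refl) → here refl ; (there i) → there (q⊆p i) }

module _ {A : Set} where

  ∈-─ : ∀ {x y} {L : List A} (x∈L : x ∈ L) → y ∈ L → x ≢ y → y ∈ (L ─ x∈L)
  ∈-─ (here refl) (here refl) x≢y = ⊥-elim (x≢y refl)
  ∈-─ (here refl) (there y∈L) _   = y∈L
  ∈-─ (there x∈L) (here refl) _   = here refl
  ∈-─ (there x∈L) (there y∈L) x≢y = there (∈-─ x∈L y∈L x≢y)

module _ {A B : Set} (label : A → B) where

  Labelled : List A → B → Set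
  Labelled L b = Σ A λ x → x ∈ L × label x ≡ b

  distinct-labels-≤ : ∀ {bs} (L : List A) → Unique bs → All (Labelled L) bs → length bs ≤ length L
  distinct-labels-≤ L [] [] = z≤n
  distinct-labels-≤ L (b∉bs ∷ ubs) ((x , x∈L , refl) ∷ xs) =
    subst (suc _ ≤_) (sym (length-removeAt′ L (Any.index x∈L)))
          (s≤s (distinct-labels-≤ (L ─ x∈L) ubs (remove b∉bs xs)))
    where
      remove : ∀ {bs} → All (label x ≢_) bs → All (Labelled L) bs → All (Labelled (L ─ x∈L)) bs
      remove [] [] = []
      remove (x≢ ∷ x≢s) ((y , y∈L , refl) ∷ ys) =
        (y , ∈-─ x∈L y∈L (λ { refl → x≢ refl }) , refl) ∷ remove x≢s ys

maxFin-upper : ∀ {n} (f : Fin n → ℕ) i → f i ≤ maxFin f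
maxFin-upper f Fin.zero    = m≤m⊔n (f Fin.zero) _
maxFin-upper f (Fin.suc i) = ≤-trans (maxFin-upper (f ∘ Fin.suc) i) (m≤n⊔m (f Fin.zero) _)

module _ {A : Set} where

  HasSize-cong : ∀ {P Q : A → Set} {k} → (∀ x → P x ⇔ Q x) → HasSize P k → HasSize Q k
  HasSize-cong P⇔Q (L , uL , L⇔P , |L|) = L , uL , (λ x → P⇔Q x ⇔-∘ L⇔P x) , |L|

module _ {n : ℕ} where

  allPairs : List (Fin n × Fin n)
  allPairs = cartesianProduct (allFin n) (allFin n)

  hasSize-dec : {P : Fin n × Fin n → Set} (P? : ∀ e → Dec (P e)) → HasSize P (length (filter P? allPairs))
  hasSize-dec P? = filter P? allPairs ,
    filter⁺ P? {xs = allPairs} (cartesianProduct⁺ (allFin⁺ n) (allFin⁺ n)) ,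
    (λ (x , y) → mk⇔ (proj₂ ∘ ∈-filter⁻ P? {xs = allPairs})
                     (∈-filter⁺ P? (∈-cartesianProduct⁺ (∈-allFin x) (∈-allFin y)))) ,
    refl

-- Local feedback edges in an arbitrary maximal spanning forest

module _ {n} (G : Graph n) (label : Fin n → ℕ) where

  Feedback : MaxSpanningForest G → Fin n → ℕ → Set
  Feedback F v b = Σ (Fin n × Fin n) λ e → Eloc G F v e × label (proj₂ e) ≡ b

  -- Distinct labels of the upper endpoints certify that the edges are distinct.
  ManyFeedback : MaxSpanningForest G → ℕ → Set
  ManyFeedback F m = Σ (Fin n) λ v → Σ (List ℕ) λ bs →
    Unique bs × length bs ≡ m × All (Feedback F v) bs

  -- Tree membership is undecidable for an arbitrary forest, so the case analyses producing
  -- ManyFeedback run under double negation; the conclusion, an inequality of naturals, is stable.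
  ecw-lower : ∀ {m} → (∀ F → ¬ ¬ ManyFeedback F m) → ∀ F k → EcwT G F k → m < k
  ecw-lower {m} many F _ (size , hasSize , refl) =
    decidable-stable (suc m ≤? suc (maxFin size)) λ m≮k →
      many F λ { (v , bs , ubs , refl , fbs) →
        m≮k (s≤s (≤-trans (bound v ubs fbs) (maxFin-upper size v))) }
    where
      bound : ∀ v {bs} → Unique bs → All (Feedback F v) bs → length bs ≤ size v
      bound v ubs fbs with hasSize v
      ... | L , _ , L⇔Eloc , |L|≡size = subst (_ ≤_) |L|≡size (distinct-labels-≤ (label ∘ proj₂) L ubs
        (All.map (λ (e , eloc , eq) → e , Equivalence.from (L⇔Eloc e) eloc , eq) fbs))

Linked : ∀ {A : Set} → List (A × A) → A → A → Set
Linked N x y = (x , y) ∈ N ⊎ (y , x) ∈ N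

linked? : ∀ {A : Set} → DecidableEquality A → ∀ N (x y : A) → Dec (Linked N x y)
linked? _≟ᴬ_ N x y = (x , y) ∈? N ⊎-dec (y , x) ∈? N
  where open DecMembership (≡-dec× _≟ᴬ_ _≟ᴬ_) using (_∈?_)

module _ {n} (G : Graph n) where

  Cut : List (Fin n) → List (Fin n × Fin n) → Set
  Cut S N = (∀ x y → x ∈ S → E G x y → y ∈ S ⊎ Linked N x y) ×
            ∃ λ u → ∃ λ w → u ∈ S × w ∉ S × E G u w

  Triangle : Fin n → Fin n → Fin n → Set
  Triangle x p r = toℕ x < toℕ p × toℕ p < toℕ r × E G x p × E G x r × E G p r

module _ {n} (G : Graph n) (E? : ∀ u w → Dec (E G u w)) where
  open DecMembership (_≟_ {n}) using (_∈?_)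

  cut? : ∀ S N → Dec (Cut G S N)
  cut? S N = (all? λ x → all? λ y → x ∈? S →-dec E? x y →-dec (y ∈? S ⊎-dec linked? _≟_ N x y)) ×-dec
             (any? λ u → any? λ w → u ∈? S ×-dec ¬? (w ∈? S) ×-dec E? u w)

  triangle? : ∀ x p r → Dec (Triangle G x p r)
  triangle? x p r = toℕ x <? toℕ p ×-dec toℕ p <? toℕ r ×-dec E? x p ×-dec E? x r ×-dec E? p r

module Forest {n} {G : Graph n} (E? : ∀ u w → Dec (E G u w)) (label : Fin n → ℕ)
  (F : MaxSpanningForest G) where
  open DecMembership (_≟_ {n}) using (_∈?_)
  open RawMonad (¬¬-Monad {0ℓ}) using (return; _>>=_)

  NonTree : List (Fin n × Fin n) → Set
  NonTree = All λ (x , y) → ¬ T F x y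

  cut-absurd : ∀ {S N} → Cut G S N → NonTree N → ⊥
  cut-absurd {S} (closed , u , w , u∈S , w∉S , uw) nt =
    proj₂ (Any.satisfied (walk-exits (_∈ S) (λ _ → ⊥) stays u∈S w∉S (proj₁ (maximal F uw))))
    where
      stays : ∀ {x y} → x ∈ S → T F x y → y ∈ S ⊎ ⊥
      stays x∈S t with closed _ _ x∈S (T⊆E F t)
      ... | inj₁ y∈S        = inj₁ y∈S
      ... | inj₂ (inj₁ xy∈N) = ⊥-elim (All.lookup nt xy∈N t)
      ... | inj₂ (inj₂ yx∈N) = ⊥-elim (All.lookup nt yx∈N (T-sym F t))

  no-triangle : ∀ {a b c} → T F a b → T F b c → T F c a → Unique (a ∷ b ∷ c ∷ []) → ⊥
  no-triangle ab bc ca u = acyclic F (_ , _ , (ab ∷ bc ∷ [ _ ] , u) , s≤s (s≤s (s≤s z≤n)) , ca)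

  no-square : ∀ {a b c d} → T F a b → T F b c → T F c d → T F d a → Unique (a ∷ b ∷ c ∷ d ∷ []) → ⊥
  no-square ab bc cd da u = acyclic F (_ , _ , (ab ∷ bc ∷ cd ∷ [ _ ] , u) , s≤s (s≤s (s≤s z≤n)) , da)

  path-avoiding-absurd : ∀ {c x y} → T F c x → T F y c → (p : Path (T F) x y) →
                         c ∉ verts (proj₁ p) → x ≢ y → ⊥
  path-avoiding-absurd cx yc (p , up) c∉p x≢y =
    acyclic F (_ , _ , (cx ∷ p , ¬Any⇒All¬ (verts p) c∉p ∷ up) , long p x≢y , yc)
    where
      long : ∀ {x y} (p : Walk (T F) x y) → x ≢ y → 3 ≤ suc (length (verts p))
      long [ _ ]         x≢x = ⊥-elim (x≢x refl)
      long (_ ∷ [ _ ])   _   = s≤s (s≤s (s≤s z≤n))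
      long (_ ∷ (_ ∷ _)) _   = s≤s (s≤s (s≤s z≤n))

  between-neighbours : ∀ {c x y} → T F c x → T F c y → x ≢ y → (p : Walk (T F) x y) → c ∈ verts p
  between-neighbours cx cy x≢y p with loop-erase p
  ... | q , q⊆p with _ ∈? verts (proj₁ q)
  ...   | yes c∈q = q⊆p c∈q
  ...   | no  c∉q = ⊥-elim (path-avoiding-absurd cx (T-sym F cy) q c∉q x≢y)

  between-neighbours-▷ : ∀ {c x y z} → T F c x → T F c y → x ≢ y → c ≢ y → T F z y →
                         (p : Walk (T F) x z) → c ∈ verts p
  between-neighbours-▷ cx cy x≢y c≢y zy p with ∈-▷ p zy (between-neighbours cx cy x≢y (p ▷ zy))
  ... | inj₁ c∈p = c∈p
  ... | inj₂ c≡y = ⊥-elim (c≢y c≡y)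

  between-neighbours-∷ : ∀ {c x y z} → T F c x → T F c y → x ≢ y → c ≢ x → T F x z →
                         (p : Walk (T F) z y) → c ∈ verts p
  between-neighbours-∷ cx cy x≢y c≢x xz p with between-neighbours cx cy x≢y (xz ∷ p)
  ... | here c≡x  = ⊥-elim (c≢x c≡x)
  ... | there c∈p = c∈p

  feedback : ∀ {v} u w → {_ : True (toℕ u <? toℕ w ×-dec E? u w)} → ¬ T F u w →
             (∀ (p : Walk (T F) u w) → v ∈ verts p) → Feedback G label F v (label w)
  feedback u w {ok} ¬t through =
    let u<w , uw = toWitness ok in (u , w) , (u<w , uw , ¬t , maximal F uw , through _) , refl

  triangle-feedback : ∀ x p r → {_ : True (triangle? G E? x p r ×-dec label r ℕ.≟ label p)} →
                     ¬ ¬ Feedback G label F x (label p)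
  triangle-feedback x p r {ok} with toWitness ok
  ... | (x<p , p<r , xp , xr , pr) , same-label = do
    yes tp ← ¬¬-excluded-middle where
      no ¬tp → return (feedback x p {fromWitness (x<p , xp)} ¬tp head∈)
    yes tr ← ¬¬-excluded-middle where
      no ¬tr → return (relabel (feedback x r {fromWitness (x<r , xr)} ¬tr head∈))
    no ¬tpr ← ¬¬-excluded-middle where
      yes tpr → ⊥-elim (no-triangle tp tpr (T-sym F tr) pairwise-distinct)
    return (relabel (feedback p r {fromWitness (p<r , pr)} ¬tpr (between-neighbours tp tr p≢r)))
    where
      x<r = <-trans x<p p<r
      p≢r : p ≢ r
      p≢r refl = <-irrefl refl p<r
      pairwise-distinct : Unique (x ∷ p ∷ r ∷ [])
      pairwise-distinct = ((λ { refl → <-irrefl refl x<p }) ∷ (λ { refl → <-irrefl refl x<r }) ∷ []) ∷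
                 (p≢r ∷ []) ∷ [] ∷ []
      relabel : Feedback G label F x (label r) → Feedback G label F x (label p)
      relabel (e , eloc , eq) = e , eloc , trans eq same-label

  collect : ∀ {v bs} → All (Feedback G label F v) bs → {_ : True (unique? ℕ._≟_ bs)} →
            ManyFeedback G label F (length bs)
  collect {v} {bs} fbs {ok} = v , bs , toWitness ok , refl , fbs

-- Spanning trees given by parent pointers

-- branch v x stands for the component of R - v containing x: edges avoiding v keep it (stay),
-- and distinct neighbours of v lie in distinct components (split).
module BranchLabelling {n} {B : Set} (R : Rel n) (R-sym : ∀ {x y} → R x y → R y x)
  (branch : Fin n → Fin n → B)
  (stay  : ∀ v x y → R x y → x ≢ v → y ≢ v → branch v x ≡ branch v y)
  (split : ∀ v y w → R v y → R v w → branch v y ≡ branch v w → y ≡ w) where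

  avoid : ∀ v {x y} (p : Walk R x y) → v ∉ verts p → branch v x ≡ branch v y
  avoid v [ x ] _ = refl
  avoid v (_∷_ {_} {y} e p) v∉ =
    trans (stay v _ y e (λ { refl → v∉ (here refl) }) (λ { refl → v∉ (there (head∈ p)) }))
          (avoid v p (v∉ ∘ there))

  through : ∀ v {u w} (p : Walk R u w) → Unique (verts p) → v ∈ verts p → u ≢ v → w ≢ v →
            branch v u ≢ branch v w
  through v [ u ] _ (here refl) u≢v _ = ⊥-elim (u≢v refl)
  through v (_∷_ {u} {y} e q) (u∉q ∷ uq) v∈p u≢v w≢v with y ≟ v
  ... | no y≢v = λ eq → through v q uq (tail v∈p) y≢v w≢v (trans (sym (stay v u y e u≢v y≢v)) eq)
    where
      tail : v ∈ verts (e ∷ q) → v ∈ verts q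
      tail (here refl) = ⊥-elim (u≢v refl)
      tail (there v∈q) = v∈q
  through v (e ∷ [ _ ]) _ _ _ w≢v | yes refl = ⊥-elim (w≢v refl)
  through v (e ∷ (f ∷ q)) (u∉q ∷ (v∉q ∷ _)) _ _ _ | yes refl = λ eq →
    let u≡y = split v _ _ (R-sym e) f (trans eq (sym (avoid v q (All¬⇒¬Any v∉q))))
    in  All.lookup u∉q (there (subst (_∈ verts q) (sym u≡y) (head∈ q))) refl

  branch-acyclic : ¬ HasCycle R
  branch-acyclic (_ , _ , ([ _ ] , _) , s≤s () , _)
  branch-acyclic (u , w , (e ∷ q , u∉q ∷ uq) , _ , wu)
    with split u _ _ e (R-sym wu) (avoid u q (All¬⇒¬Any u∉q))
  branch-acyclic (u , w , (e ∷ [ _ ] , _) , s≤s (s≤s ()) , _) | refl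
  branch-acyclic (u , w , (e ∷ (f ∷ q) , _ ∷ (w∉q ∷ _)) , _ , _) | refl = All.lookup w∉q (last∈ q) refl

module ParentForest {n} (parent : Fin n → Fin n) where

  Tree : Rel n
  Tree x y = x ≢ y × (parent x ≡ y ⊎ parent y ≡ x)

  Tree-sym : ∀ {x y} → Tree x y → Tree y x
  Tree-sym (x≢y , inj₁ px≡y) = x≢y ∘ sym , inj₂ px≡y
  Tree-sym (x≢y , inj₂ py≡x) = x≢y ∘ sym , inj₁ py≡x

  Tree? : ∀ x y → Dec (Tree x y)
  Tree? x y = ¬? (x ≟ y) ×-dec (parent x ≟ y ⊎-dec parent y ≟ x)

  climb : ℕ → (x : Fin n) → Σ (Fin n) (Walk Tree x)
  climb zero    x = x , [ x ]
  climb (suc k) x with x ≟ parent x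
  ... | yes _    = x , [ x ]
  ... | no x≢px  = let r , p = climb k (parent x) in r , (x≢px , inj₁ refl) ∷ p

  root : Fin n → Fin n
  root x = proj₁ (climb n x)

  before : Fin n → List (Fin n) → Maybe (Fin n)
  before v (y ∷ z ∷ zs) = if does (z ≟ v) then just y else before v (z ∷ zs)
  before v _ = nothing

  branch : Fin n → Fin n → Maybe (Fin n)
  branch v x = before v (verts (proj₂ (climb n x)))

  _≟ᴮ_ : (b b′ : Maybe (Fin n)) → Dec (b ≡ b′)
  _≟ᴮ_ = ≡-dec _≟_

  stays? : Dec (∀ v x y → Tree x y → x ≢ v → y ≢ v → branch v x ≡ branch v y)
  stays? = all? λ v → all? λ x → all? λ y →
    Tree? x y →-dec ¬? (x ≟ v) →-dec ¬? (y ≟ v) →-dec branch v x ≟ᴮ branch v y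

  splits? : Dec (∀ v y w → Tree v y → Tree v w → branch v y ≡ branch v w → y ≡ w)
  splits? = all? λ v → all? λ y → all? λ w →
    Tree? v y →-dec Tree? v w →-dec branch v y ≟ᴮ branch v w →-dec y ≟ w

  module _ (G : Graph n) (E? : ∀ x y → Dec (E G x y)) where
    open DecMembership (_≟_ {n}) using (_∈?_)

    inside? : Dec (∀ x y → Tree x y → E G x y)
    inside? = all? λ x → all? λ y → Tree? x y →-dec E? x y

    spanning? : Dec (∀ x y → E G x y → root x ≡ root y)
    spanning? = all? λ x → all? λ y → E? x y →-dec root x ≟ root y

    Separates : Fin n → Fin n → Fin n → Set
    Separates v u w = u ≡ v ⊎ w ≡ v ⊎ branch v u ≢ branch v w

    LocalFeedback : Fin n → Fin n × Fin n → Set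
    LocalFeedback v (u , w) = toℕ u < toℕ w × E G u w × ¬ Tree u w × Separates v u w

    localFeedback? : ∀ v e → Dec (LocalFeedback v e)
    localFeedback? v (u , w) = toℕ u <? toℕ w ×-dec E? u w ×-dec ¬? (Tree? u w) ×-dec
      (u ≟ v ⊎-dec w ≟ v ⊎-dec ¬? (branch v u ≟ᴮ branch v w))

    size : Fin n → ℕ
    size v = length (filter (localFeedback? v) allPairs)

    module Certified
      (tree⊆E    : ∀ x y → Tree x y → E G x y)
      (same-root : ∀ x y → E G x y → root x ≡ root y)
      (stay      : ∀ v x y → Tree x y → x ≢ v → y ≢ v → branch v x ≡ branch v y)
      (split     : ∀ v y w → Tree v y → Tree v w → branch v y ≡ branch v w → y ≡ w) where

      open BranchLabelling Tree Tree-sym branch stay split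

      connect : ∀ {u w} → E G u w → Path Tree u w
      connect {u} {w} e = proj₁ (loop-erase (proj₂ (climb n u) ++ᵂ
        subst (λ r → Walk Tree r w) (sym (same-root u w e)) (reverseᵂ Tree-sym (proj₂ (climb n w)))))

      forest : MaxSpanningForest G
      forest = record
        { T       = Tree
        ; T-sym   = Tree-sym
        ; T⊆E     = tree⊆E _ _
        ; acyclic = branch-acyclic
        ; maximal = connect
        }

      Eloc⇔LocalFeedback : ∀ v e → Eloc G forest v e ⇔ LocalFeedback v e
      Eloc⇔LocalFeedback v (u , w) = mk⇔ to from
        where
          to : Eloc G forest v (u , w) → LocalFeedback v (u , w)
          to (u<w , e , ¬t , (p , up) , v∈p) with u ≟ v | w ≟ v
          ... | yes u≡v | _       = u<w , e , ¬t , inj₁ u≡v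
          ... | no  _   | yes w≡v = u<w , e , ¬t , inj₂ (inj₁ w≡v)
          ... | no  u≢v | no  w≢v = u<w , e , ¬t , inj₂ (inj₂ (through v p up v∈p u≢v w≢v))
          on-path : (e : E G u w) → Separates v u w → v ∈ verts (proj₁ (connect e))
          on-path e (inj₁ refl)          = head∈ _
          on-path e (inj₂ (inj₁ refl))   = last∈ _
          on-path e (inj₂ (inj₂ differ)) with v ∈? verts (proj₁ (connect e))
          ... | yes v∈p = v∈p
          ... | no  v∉p = ⊥-elim (differ (avoid v _ v∉p))
          from : LocalFeedback v (u , w) → Eloc G forest v (u , w)
          from (u<w , e , ¬t , sep) = u<w , e , ¬t , connect e , on-path e sep

      ecwT : EcwT G forest (suc (maxFin size))
      ecwT = size ,
        (λ v → HasSize-cong (λ e → ⇔-sym (Eloc⇔LocalFeedback v e)) (hasSize-dec (localFeedback? v))) ,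
        refl

    certified : {_ : True inside?} {_ : True spanning?} {_ : True stays?} {_ : True splits?} →
                Σ (MaxSpanningForest G) λ F → EcwT G F (suc (maxFin size))
    certified {ok₁} {ok₂} {ok₃} {ok₄} = forest , ecwT
      where open Certified (toWitness ok₁) (toWitness ok₂) (toWitness ok₃) (toWitness ok₄)

record SameEdges {n} (G G′ : Graph n) : Set where
  constructor same-edges
  field edges⇔ : ∀ u w → E G u w ⇔ E G′ u w
open SameEdges

SameEdges-sym : ∀ {n} {G G′ : Graph n} → SameEdges G G′ → SameEdges G′ G
SameEdges-sym same = same-edges λ u w → ⇔-sym (edges⇔ same u w)

module _ {n} {G G′ : Graph n} (same : SameEdges G G′) where

  forest-transfer : MaxSpanningForest G → MaxSpanningForest G′
  forest-transfer F = record
    { T       = T F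
    ; T-sym   = T-sym F
    ; T⊆E     = Equivalence.to (edges⇔ same _ _) ∘ T⊆E F
    ; acyclic = acyclic F
    ; maximal = maximal F ∘ Equivalence.from (edges⇔ same _ _)
    }

  ecwT-transfer : ∀ F {k} → EcwT G F k → EcwT G′ (forest-transfer F) k
  ecwT-transfer F (size , hasSize , k≡) = size , (λ v → HasSize-cong (Eloc-transfer v) (hasSize v)) , k≡
    where
      Eloc-transfer : ∀ v e → Eloc G F v e ⇔ Eloc G′ (forest-transfer F) v e
      Eloc-transfer v (u , w) = mk⇔
        (λ (u<w , uw , ¬t , p , v∈p) → u<w , Equivalence.to (edges⇔ same u w) uw , ¬t , p , v∈p)
        (λ (u<w , uw , ¬t , p , v∈p) → u<w , Equivalence.from (edges⇔ same u w) uw , ¬t , p , v∈p)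

ecw-transfer : ∀ {n} {G G′ : Graph n} {k} → SameEdges G G′ → Ecw G k → Ecw G′ k
ecw-transfer same ((F , ecwF) , least) =
  (forest-transfer same F , ecwT-transfer same F ecwF) ,
  λ F′ k′ ecwF′ →
    least (forest-transfer (SameEdges-sym same) F′) k′ (ecwT-transfer (SameEdges-sym same) F′ ecwF′)

module _ {n} (G G′ : Graph n) (E? : ∀ u w → Dec (E G u w)) (E′? : ∀ u w → Dec (E G′ u w)) where

  sameEdges : {_ : True (all? λ u → all? λ w → (E? u w →-dec E′? u w) ×-dec (E′? u w →-dec E? u w))} →
              SameEdges G G′
  sameEdges {ok} = same-edges λ u w → let to , from = toWitness ok u w in mk⇔ to from

edge-deleted? : ∀ {n} (G : Graph n) → (∀ u w → Dec (E G u w)) → ∀ e u w → Dec (E (G -ᵉ e) u w)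
edge-deleted? _ E? (a , b , _) u w = E? u w ×-dec ¬? ((u ≟ a ×-dec w ≟ b) ⊎-dec (u ≟ b ×-dec w ≟ a))

vertex-deleted? : ∀ {m} (H : Graph (suc m)) → (∀ u w → Dec (E H u w)) → ∀ v u w → Dec (E (H -ᵛ v) u w)
vertex-deleted? _ E? v u w = E? (punchIn v u) (punchIn v w)

Loopless : List (ℕ × ℕ) → Set
Loopless = All λ e → proj₁ e ≢ proj₂ e

loopless? : ∀ es → Dec (Loopless es)
loopless? = All.all? λ e → ¬? (proj₁ e ℕ.≟ proj₂ e)

edgeGraph : ∀ {n} (es : List (ℕ × ℕ)) → Loopless es → Graph n
edgeGraph es loopless = record
  { E     = λ u w → Linked es (toℕ u) (toℕ w)
  ; sym   = swap
  ; irref = λ { (inj₁ uu∈es) → All.lookup loopless uu∈es refl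
              ; (inj₂ uu∈es) → All.lookup loopless uu∈es refl }
  }

edge? : ∀ {n} es loopless (u w : Fin n) → Dec (E (edgeGraph es loopless) u w)
edge? es _ u w = linked? ℕ._≟_ es (toℕ u) (toℕ w)

distinct : ∀ {n} (xs : List (Fin n)) → {_ : True (unique? _≟_ xs)} → Unique xs
distinct _ {ok} = toWitness ok

-- The examples

data Pole : Set where
  north south : Pole

pole : Pole → Fin 17
pole north = # 0
pole south = # 1

opposite : Pole → Pole
opposite north = south
opposite south = north

poles-differ : ∀ p → pole (opposite p) ≢ pole p
poles-differ north ()
poles-differ south ()

∀-pole? : {P : Pole → Set} → (∀ p → Dec (P p)) → Dec (∀ p → P p)
∀-pole? P? = map′ (λ (n , s) → λ { north → n ; south → s }) (λ all → all north , all south)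
                  (P? north ×-dec P? south)

triangle : ℕ → ℕ → ℕ → List (ℕ × ℕ)
triangle x p r = (x , p) ∷ (x , r) ∷ (p , r) ∷ []

K-edges : List (ℕ × ℕ)
K-edges = (0 , 2) ∷ (1 , 2) ∷ (0 , 3) ∷ (1 , 3) ∷ (0 , 4) ∷ (1 , 4) ∷
  triangle 2 5 6 ++ triangle 2 7 8 ++ triangle 3 9 10 ++ triangle 3 11 12 ++
  triangle 4 13 14 ++ triangle 4 15 16

K-loopless : Loopless K-edges
K-loopless = from-yes (loopless? K-edges)

K : Graph 17
K = edgeGraph K-edges K-loopless

K-edge? : ∀ u w → Dec (E K u w)
K-edge? = edge? K-edges K-loopless

K-label : Fin 17 → ℕ
K-label = Vec.lookup (0 ∷ 1 ∷ 2 ∷ 3 ∷ 4 ∷ 5 ∷ 5 ∷ 7 ∷ 7 ∷ 9 ∷ 9 ∷ 11 ∷ 11 ∷ 13 ∷ 13 ∷ 15 ∷ 15 ∷ [])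

K-cluster : Fin 17 → List (Fin 17)
K-cluster c = c ∷ pendants (toℕ c)
  where
    pendants : ℕ → List (Fin 17)
    pendants 2 = # 5 ∷ # 6 ∷ # 7 ∷ # 8 ∷ []
    pendants 3 = # 9 ∷ # 10 ∷ # 11 ∷ # 12 ∷ []
    pendants 4 = # 13 ∷ # 14 ∷ # 15 ∷ # 16 ∷ []
    pendants _ = []

-- The south pole with the clusters of the hubs whose only tree edge to a pole goes south.
K-south : Pole → Pole → Pole → List (Fin 17)
K-south p₂ p₃ p₄ = pole south ∷ hanging p₂ (# 2) ++ hanging p₃ (# 3) ++ hanging p₄ (# 4)
  where
    hanging : Pole → Fin 17 → List (Fin 17)
    hanging north c = []
    hanging south c = K-cluster c

K-cross : Pole → Pole → Pole → List (Fin 17 × Fin 17)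
K-cross p₂ p₃ p₄ =
  (pole (opposite p₂) , # 2) ∷ (pole (opposite p₃) , # 3) ∷ (pole (opposite p₄) , # 4) ∷ []

K-south-cut : ∀ p₂ p₃ p₄ → Cut K (K-south p₂ p₃ p₄) (K-cross p₂ p₃ p₄)
K-south-cut = from-yes (∀-pole? λ p₂ → ∀-pole? λ p₃ → ∀-pole? λ p₄ →
  cut? K K-edge? (K-south p₂ p₃ p₄) (K-cross p₂ p₃ p₄))

module K-lower (F : MaxSpanningForest K) where
  open Forest K-edge? K-label F
  open RawMonad (¬¬-Monad {0ℓ}) using (return; _>>=_)

  Full : Fin 17 → Set
  Full c = ∀ p → T F (pole p) c

  data Attachment (c : Fin 17) : Set where
    full   : Full c → Attachment c
    single : ∀ p → T F (pole p) c → ¬ T F (pole (opposite p)) c → Attachment c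

  attachment : ∀ c → {_ : True (cut? K K-edge? (K-cluster c) ((# 0 , c) ∷ (# 1 , c) ∷ []))} →
               ¬ ¬ Attachment c
  attachment c {cut} = do
    t₀ ← ¬¬-excluded-middle
    t₁ ← ¬¬-excluded-middle
    return (classify t₀ t₁)
    where
      classify : Dec (T F (pole north) c) → Dec (T F (pole south) c) → Attachment c
      classify (yes t₀) (yes t₁) = full λ { north → t₀ ; south → t₁ }
      classify (yes t₀) (no ¬t₁) = single north t₀ ¬t₁
      classify (no ¬t₀) (yes t₁) = single south t₁ ¬t₀
      classify (no ¬t₀) (no ¬t₁) = ⊥-elim (cut-absurd (toWitness cut) (¬t₀ ∷ ¬t₁ ∷ []))

  two-full-absurd : ∀ {c d} → Full c → Full d → {_ : True (unique? _≟_ (# 0 ∷ c ∷ # 1 ∷ d ∷ []))} → ⊥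
  two-full-absurd fc fd {ok} =
    no-square (fc north) (T-sym F (fc south)) (fd south) (T-sym F (fd north)) (toWitness ok)

  hub-feedback : ∀ {c d} p → Full c → T F (pole p) d → ¬ T F (pole (opposite p)) d →
    {_ : True (∀-pole? λ q → (toℕ (pole q) <? toℕ d ×-dec K-edge? (pole q) d) ×-dec ¬? (c ≟ pole q))} →
    Feedback K K-label F c (K-label d)
  -- As c is full, the tree path from the far pole of d to d is: far pole, c, near pole, d.
  hub-feedback {d = d} p fc t ¬t {ok} =
    feedback (pole (opposite p)) d {fromWitness (proj₁ (facts (opposite p)))} ¬t
      (between-neighbours-▷ (T-sym F (fc (opposite p))) (T-sym F (fc p)) (poles-differ p)
                            (proj₂ (facts p)) (T-sym F t))
    where facts = toWitness ok

  many-feedback : ¬ ¬ ManyFeedback K K-label F 4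
  many-feedback = do
    a₂ ← attachment (# 2)
    a₃ ← attachment (# 3)
    a₄ ← attachment (# 4)
    classify a₂ a₃ a₄
    where
      classify : Attachment (# 2) → Attachment (# 3) → Attachment (# 4) → ¬ ¬ ManyFeedback K K-label F 4
      classify (full f₂) (full f₃) _ = ⊥-elim (two-full-absurd f₂ f₃)
      classify (full f₂) _ (full f₄) = ⊥-elim (two-full-absurd f₂ f₄)
      classify _ (full f₃) (full f₄) = ⊥-elim (two-full-absurd f₃ f₄)
      classify (full f₂) (single p₃ t₃ ¬t₃) (single p₄ t₄ ¬t₄) = do
        t ← triangle-feedback (# 2) (# 5) (# 6)
        t′ ← triangle-feedback (# 2) (# 7) (# 8)
        return (collect (t ∷ t′ ∷ hub-feedback p₃ f₂ t₃ ¬t₃ ∷ hub-feedback p₄ f₂ t₄ ¬t₄ ∷ []))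
      classify (single p₂ t₂ ¬t₂) (full f₃) (single p₄ t₄ ¬t₄) = do
        t ← triangle-feedback (# 3) (# 9) (# 10)
        t′ ← triangle-feedback (# 3) (# 11) (# 12)
        return (collect (t ∷ t′ ∷ hub-feedback p₂ f₃ t₂ ¬t₂ ∷ hub-feedback p₄ f₃ t₄ ¬t₄ ∷ []))
      classify (single p₂ t₂ ¬t₂) (single p₃ t₃ ¬t₃) (full f₄) = do
        t ← triangle-feedback (# 4) (# 13) (# 14)
        t′ ← triangle-feedback (# 4) (# 15) (# 16)
        return (collect (t ∷ t′ ∷ hub-feedback p₂ f₄ t₂ ¬t₂ ∷ hub-feedback p₃ f₄ t₃ ¬t₃ ∷ []))
      classify (single p₂ _ ¬t₂) (single p₃ _ ¬t₃) (single p₄ _ ¬t₄) =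
        ⊥-elim (cut-absurd (K-south-cut p₂ p₃ p₄) (¬t₂ ∷ ¬t₃ ∷ ¬t₄ ∷ []))

K-parent : Fin 17 → Fin 17
K-parent = Vec.lookup (# 0 ∷ # 2 ∷ # 0 ∷ # 0 ∷ # 0 ∷ # 2 ∷ # 2 ∷ # 2 ∷ # 2 ∷
                        # 3 ∷ # 3 ∷ # 3 ∷ # 3 ∷ # 4 ∷ # 4 ∷ # 4 ∷ # 4 ∷ [])

K-ecw : Ecw K 5
K-ecw = ParentForest.certified K-parent K K-edge? , ecw-lower K K-label K-lower.many-feedback

G-edges : List (ℕ × ℕ)
G-edges = (0 , 1) ∷ K-edges

G-loopless : Loopless G-edges
G-loopless = from-yes (loopless? G-edges)

G : Graph 17
G = edgeGraph G-edges G-loopless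

G-edge? : ∀ u w → Dec (E G u w)
G-edge? = edge? G-edges G-loopless

G-01 : Σ (Fin 17) λ a → Σ (Fin 17) λ b → E G a b
G-01 = # 0 , # 1 , inj₁ (here refl)

module G-lower (F : MaxSpanningForest G) where
  open Forest G-edge? K-label F
  open RawMonad (¬¬-Monad {0ℓ}) using (return; _>>=_)

  many-feedback : ¬ ¬ ManyFeedback G K-label F 3
  many-feedback = do
    t ← triangle-feedback (# 2) (# 5) (# 6)
    t′ ← triangle-feedback (# 2) (# 7) (# 8)
    yes t₀ ← ¬¬-excluded-middle where
      no ¬t₀ → return (collect (t ∷ t′ ∷ feedback (# 0) (# 2) ¬t₀ last∈ ∷ []))
    yes t₁ ← ¬¬-excluded-middle where
      no ¬t₁ → return (collect (t ∷ t′ ∷ feedback (# 1) (# 2) ¬t₁ last∈ ∷ []))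
    no ¬t₀₁ ← ¬¬-excluded-middle where
      yes t₀₁ → ⊥-elim (no-triangle t₀₁ t₁ (T-sym F t₀) (distinct _))
    return (collect (t ∷ t′ ∷ feedback (# 0) (# 1) ¬t₀₁
      (between-neighbours (T-sym F t₀) (T-sym F t₁) (λ ())) ∷ []))

G-parent : Fin 17 → Fin 17
G-parent = Vec.lookup (# 0 ∷ # 0 ∷ # 0 ∷ # 0 ∷ # 0 ∷ # 2 ∷ # 2 ∷ # 2 ∷ # 2 ∷
                        # 3 ∷ # 3 ∷ # 3 ∷ # 3 ∷ # 4 ∷ # 4 ∷ # 4 ∷ # 4 ∷ [])

G-ecw : Ecw G 4
G-ecw = ParentForest.certified G-parent G G-edge? , ecw-lower G K-label G-lower.many-feedback

H-edges : List (ℕ × ℕ)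
H-edges = (0 , 1) ∷ (0 , 2) ∷ List.map (Product.map suc suc) K-edges

H-loopless : Loopless H-edges
H-loopless = from-yes (loopless? H-edges)

H : Graph 18
H = edgeGraph H-edges H-loopless

H-edge? : ∀ u w → Dec (E H u w)
H-edge? = edge? H-edges H-loopless

H-label : Fin 18 → ℕ
H-label = Vec.lookup (0 ∷ 1 ∷ 2 ∷ 3 ∷ 4 ∷ 5 ∷ 6 ∷ 6 ∷ 8 ∷ 8 ∷ 10 ∷ 10 ∷ 12 ∷ 12 ∷ 14 ∷ 14 ∷ 16 ∷ 16 ∷ [])

H-0-cut : Cut H (# 0 ∷ []) ((# 0 , # 1) ∷ (# 0 , # 2) ∷ [])
H-0-cut = from-yes (cut? H H-edge? (# 0 ∷ []) ((# 0 , # 1) ∷ (# 0 , # 2) ∷ []))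

module H-lower (F : MaxSpanningForest H) where
  open Forest H-edge? H-label F
  open RawMonad (¬¬-Monad {0ℓ}) using (return; _>>=_)

  many-feedback : ¬ ¬ ManyFeedback H H-label F 3
  many-feedback = do
    t ← triangle-feedback (# 3) (# 6) (# 7)
    t′ ← triangle-feedback (# 3) (# 8) (# 9)
    yes t₁ ← ¬¬-excluded-middle where
      no ¬t₁ → return (collect (t ∷ t′ ∷ feedback (# 1) (# 3) ¬t₁ last∈ ∷ []))
    yes t₂ ← ¬¬-excluded-middle where
      no ¬t₂ → return (collect (t ∷ t′ ∷ feedback (# 2) (# 3) ¬t₂ last∈ ∷ []))
    yes t₀₁ ← ¬¬-excluded-middle where
      no ¬t₀₁ → do
        yes t₀₂ ← ¬¬-excluded-middle where
          no ¬t₀₂ → ⊥-elim (cut-absurd H-0-cut (¬t₀₁ ∷ ¬t₀₂ ∷ []))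
        return (collect (t ∷ t′ ∷ feedback (# 0) (# 1) ¬t₀₁
          (between-neighbours-∷ (T-sym F t₂) (T-sym F t₁) (λ ()) (λ ()) (T-sym F t₀₂)) ∷ []))
    no ¬t₀₂ ← ¬¬-excluded-middle where
      yes t₀₂ → ⊥-elim (no-square t₀₁ t₁ (T-sym F t₂) (T-sym F t₀₂) (distinct _))
    return (collect (t ∷ t′ ∷ feedback (# 0) (# 2) ¬t₀₂
      (between-neighbours-∷ (T-sym F t₁) (T-sym F t₂) (λ ()) (λ ()) (T-sym F t₀₁)) ∷ []))

H-parent : Fin 18 → Fin 18
H-parent = Vec.lookup (# 1 ∷ # 1 ∷ # 0 ∷ # 1 ∷ # 1 ∷ # 1 ∷ # 3 ∷ # 3 ∷ # 3 ∷ # 3 ∷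
                        # 4 ∷ # 4 ∷ # 4 ∷ # 4 ∷ # 5 ∷ # 5 ∷ # 5 ∷ # 5 ∷ [])

H-ecw : Ecw H 4
H-ecw = ParentForest.certified H-parent H H-edge? , ecw-lower H H-label H-lower.many-feedback

corollary1 : (Σ ℕ λ n → Σ (Graph n) λ G →
               Σ (Σ (Fin n) λ a → Σ (Fin n) λ b → E G a b) λ e →
               Σ ℕ λ k₁ → Σ ℕ λ k₂ → Ecw G k₁ × Ecw (G -ᵉ e) k₂ × k₁ < k₂)
           × (Σ ℕ λ m → Σ (Graph (suc m)) λ H → Σ (Fin (suc m)) λ v →
               Σ ℕ λ k₁ → Σ ℕ λ k₂ → Ecw H k₁ × Ecw (H -ᵛ v) k₂ × k₁ < k₂)
corollary1 =
  (17 , G , G-01 , 4 , 5 , G-ecw , ecw-transfer G-01-deleted K-ecw , n<1+n 4) ,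
  (17 , H , # 0 , 4 , 5 , H-ecw , ecw-transfer H-0-deleted K-ecw , n<1+n 4)
  where
    G-01-deleted : SameEdges K (G -ᵉ G-01)
    G-01-deleted = sameEdges K (G -ᵉ G-01) K-edge? (edge-deleted? G G-edge? G-01)
    H-0-deleted : SameEdges K (H -ᵛ (# 0))
    H-0-deleted = sameEdges K (H -ᵛ (# 0)) K-edge? (vertex-deleted? H H-edge? (# 0))
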